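{- Let $d\ge1$ be an integer, let $K$ be a field whose characteristic does not divide $d$, let $k\in K$, and let $X_{d,k}$ be the affine plane curve $T_d(x)+T_d(y)=k$, where $T_d$ is the monic Chebyshev polynomial of degree $d$ (characterized by $T_d(z+z^{ -1})=z^d+z^{ -d}$). If $k\neq0$ and $k\neq\pm4$ in $K$, then $X_{d,k}$ is nonsingular. In particular, if $K$ is a number field, the curve $X_d:T_d(x)+T_d(y)=1$ is nonsingular. -}

module Defs where

open import Level using (_⊔_)
open import Data.Nat using (ℕ; zero; suc)
open import Data.List using (List; []; _∷_)
open import Data.Product using (Σ; _×_)
open import Relation.Nullary using (¬_)
open import Data.Empty using (⊥)
open import Algebra.Bundles using (CommutativeRing)

record IsField {c ℓ} (R : CommutativeRing c ℓ) : Set (c ⊔ ℓ) where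
  open CommutativeRing R
  field
    1≉0     : ¬ (1# ≈ 0#)
    inverse : ∀ x → ¬ (x ≈ 0#) → Σ Carrier λ y → x * y ≈ 1#

module Poly {c ℓ} (R : CommutativeRing c ℓ) where
  open CommutativeRing R

  ι : ℕ → Carrier
  ι zero    = 0#
  ι (suc n) = 1# + ι n

  -- univariate polynomials over R as coefficient lists, constant term first
  Pol : Set c
  Pol = List Carrier

  _⊕_ : Pol → Pol → Pol
  []       ⊕ q        = q
  (a ∷ p)  ⊕ []       = a ∷ p
  (a ∷ p)  ⊕ (b ∷ q)  = (a + b) ∷ (p ⊕ q)

  neg : Pol → Pol
  neg []      = []
  neg (a ∷ p) = (- a) ∷ neg p

  shift : Pol → Pol
  shift p = 0# ∷ p

  eval : Pol → Carrier → Carrier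
  eval []      x = 0#
  eval (a ∷ p) x = a + x * eval p x

  derivFrom : ℕ → Pol → Pol
  derivFrom i []      = []
  derivFrom i (a ∷ p) = (ι i * a) ∷ derivFrom (suc i) p

  deriv : Pol → Pol
  deriv []      = []
  deriv (a ∷ p) = derivFrom 1 p

  -- monic Chebyshev (Dickson) polynomials:
  -- T₀ = 2, T₁ = x, T_{n+2} = x·T_{n+1} − Tₙ,
  -- so that T_d(z + z⁻¹) = z^d + z^{-d}.
  cheb : ℕ → Pol
  cheb zero          = (1# + 1#) ∷ []
  cheb (suc zero)    = 0# ∷ 1# ∷ []
  cheb (suc (suc n)) = shift (cheb (suc n)) ⊕ neg (cheb n)

  Nonsingular : ℕ → Carrier → Set (c ⊔ ℓ)
  Nonsingular d k =
    ∀ x y → eval (cheb d) x + eval (cheb d) y ≈ k →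
      eval (deriv (cheb d)) x ≈ 0# → eval (deriv (cheb d)) y ≈ 0# → ⊥

{-# OPTIONS --safe #-}

-- With U the Chebyshev polynomials of the second kind (shifted so that
-- U₀ = 0, U₁ = 1), one has T_d′ = d·U_d and T_d² − 4 = (x² − 4)·U_d².
-- At a singular point both T_d′(x) and T_d′(y) vanish; as d ≠ 0 in K this
-- forces U_d(x) = U_d(y) = 0, hence T_d(x), T_d(y) ∈ {2, −2}, and so
-- k = T_d(x) + T_d(y) ∈ {4, 0, −4}.

module Submission where

open import Algebra.Bundles using (CommutativeRing)
open import Data.Integer as ℤ using (ℤ; +_; -[1+_]; _⊖_; _◃_)
open import Data.Sign as Sign using ()
import Data.Integer.Properties as ℤ
open import Data.List using ([]; _∷_)
open import Data.Maybe using (Maybe; just; nothing)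
open import Data.Nat as ℕ using (ℕ; zero; suc; _≥_)
import Data.Nat.Properties as ℕ
open import Data.Product using (_,_)
open import Data.Sum using (_⊎_; inj₁; inj₂; [_,_])
open import Function using (_∘_)
open import Level using (_⊔_)
import Relation.Binary.PropositionalEquality as ≡
open import Relation.Nullary using (¬_; yes; no)
open import Defs

module IntegerCoefficients {c ℓ} (R : CommutativeRing c ℓ) where
  open CommutativeRing R
  open import Algebra.Properties.Ring ring
  open import Algebra.Properties.CommutativeSemigroup +-commutativeSemigroup
    using (interchange)
  open import Algebra.Properties.Semiring.Mult.TCOptimised semiring
    using (_×_; 1+×; ×-homo-+; ×1-homo-*)
  open import Algebra.Solver.Ring.AlmostCommutativeRing
    using (AlmostCommutativeRing; _-Raw-AlmostCommutative⟶_; fromCommutativeRing)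
  open import Relation.Binary.Reasoning.Setoid setoid

  -- With the optimised _×_, the solver constants con (+ 0), con (+ 1), con (+ 2)
  -- denote 0#, 1#, 1# + 1# on the nose, as they occur in cheb.
  ⟦_⟧ : ℤ → Carrier
  ⟦ + n ⟧      = n × 1#
  ⟦ -[1+ n ] ⟧ = - (suc n × 1#)

  ⟦-⟧ : ∀ i → ⟦ ℤ.- i ⟧ ≈ - ⟦ i ⟧
  ⟦-⟧ (+ zero)  = sym -0#≈0#
  ⟦-⟧ (+ suc n) = refl
  ⟦-⟧ -[1+ n ]  = sym (-‿involutive _)

  [1+a]-[1+b]≈a-b : ∀ a b → (1# + a) - (1# + b) ≈ a - b
  [1+a]-[1+b]≈a-b a b = begin
    (1# + a) - (1# + b)       ≈⟨ +-congˡ (-‿+-comm 1# b) ⟨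
    (1# + a) + (- 1# + - b)   ≈⟨ interchange 1# a (- 1#) (- b) ⟩
    (1# - 1#) + (a - b)       ≈⟨ +-congʳ (-‿inverseʳ 1#) ⟩
    0# + (a - b)              ≈⟨ +-identityˡ _ ⟩
    a - b                     ∎

  ⟦⊖⟧ : ∀ m n → ⟦ m ⊖ n ⟧ ≈ m × 1# - n × 1#
  ⟦⊖⟧ m       zero    = sym (trans (+-congˡ -0#≈0#) (+-identityʳ _))
  ⟦⊖⟧ zero    (suc n) = sym (+-identityˡ _)
  ⟦⊖⟧ (suc m) (suc n) = begin
    ⟦ suc m ⊖ suc n ⟧                ≡⟨ ≡.cong ⟦_⟧ (ℤ.[1+m]⊖[1+n]≡m⊖n m n) ⟩
    ⟦ m ⊖ n ⟧                        ≈⟨ ⟦⊖⟧ m n ⟩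
    m × 1# - n × 1#                  ≈⟨ [1+a]-[1+b]≈a-b _ _ ⟨
    (1# + m × 1#) - (1# + n × 1#)    ≈⟨ +-cong (1+× m 1#) (-‿cong (1+× n 1#)) ⟨
    suc m × 1# - suc n × 1#          ∎

  ⟦+⟧ : ∀ i j → ⟦ i ℤ.+ j ⟧ ≈ ⟦ i ⟧ + ⟦ j ⟧
  ⟦+⟧ -[1+ m ] -[1+ n ] = begin
    - (suc (suc (m ℕ.+ n)) × 1#)        ≡⟨ ≡.cong (λ k → - (suc k × 1#)) (ℕ.+-suc m n) ⟨
    - ((suc m ℕ.+ suc n) × 1#)          ≈⟨ -‿cong (×-homo-+ 1# (suc m) (suc n)) ⟩
    - (suc m × 1# + suc n × 1#)         ≈⟨ -‿+-comm _ _ ⟨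
    - (suc m × 1#) + - (suc n × 1#)     ∎
  ⟦+⟧ -[1+ m ] (+ n)    = trans (⟦⊖⟧ n (suc m)) (+-comm _ _)
  ⟦+⟧ (+ m)    -[1+ n ] = ⟦⊖⟧ m (suc n)
  ⟦+⟧ (+ m)    (+ n)    = ×-homo-+ 1# m n

  ⟦*⟧ : ∀ i j → ⟦ i ℤ.* j ⟧ ≈ ⟦ i ⟧ * ⟦ j ⟧
  ⟦*⟧ (+ m) (+ n) = begin
    ⟦ Sign.+ ◃ m ℕ.* n ⟧         ≡⟨ ≡.cong ⟦_⟧ (ℤ.+◃n≡+n (m ℕ.* n)) ⟩
    (m ℕ.* n) × 1#               ≈⟨ ×1-homo-* m n ⟩
    m × 1# * n × 1#              ∎
  ⟦*⟧ (+ m) -[1+ n ] = begin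
    ⟦ Sign.- ◃ m ℕ.* suc n ⟧     ≡⟨ ≡.cong ⟦_⟧ (ℤ.-◃n≡-n (m ℕ.* suc n)) ⟩
    ⟦ ℤ.- + (m ℕ.* suc n) ⟧      ≈⟨ ⟦-⟧ (+ (m ℕ.* suc n)) ⟩
    - ((m ℕ.* suc n) × 1#)       ≈⟨ -‿cong (×1-homo-* m (suc n)) ⟩
    - (m × 1# * suc n × 1#)      ≈⟨ -‿distribʳ-* _ _ ⟩
    m × 1# * - (suc n × 1#)      ∎
  ⟦*⟧ -[1+ m ] (+ n) = begin
    ⟦ Sign.- ◃ suc m ℕ.* n ⟧     ≡⟨ ≡.cong ⟦_⟧ (ℤ.-◃n≡-n (suc m ℕ.* n)) ⟩
    ⟦ ℤ.- + (suc m ℕ.* n) ⟧      ≈⟨ ⟦-⟧ (+ (suc m ℕ.* n)) ⟩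
    - ((suc m ℕ.* n) × 1#)       ≈⟨ -‿cong (×1-homo-* (suc m) n) ⟩
    - (suc m × 1# * n × 1#)      ≈⟨ -‿distribˡ-* _ _ ⟩
    - (suc m × 1#) * n × 1#      ∎
  ⟦*⟧ -[1+ m ] -[1+ n ] = begin
    ⟦ Sign.+ ◃ suc m ℕ.* suc n ⟧       ≡⟨ ≡.cong ⟦_⟧ (ℤ.+◃n≡+n (suc m ℕ.* suc n)) ⟩
    (suc m ℕ.* suc n) × 1#             ≈⟨ ×1-homo-* (suc m) (suc n) ⟩
    suc m × 1# * suc n × 1#            ≈⟨ -‿involutive _ ⟨
    - - (suc m × 1# * suc n × 1#)      ≈⟨ -‿cong (-‿distribˡ-* _ _) ⟩
    - (- (suc m × 1#) * suc n × 1#)    ≈⟨ -‿distribʳ-* _ _ ⟩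
    - (suc m × 1#) * - (suc n × 1#)    ∎

  almostCommutativeRing : AlmostCommutativeRing c ℓ
  almostCommutativeRing = fromCommutativeRing R

  ℤ⟶R : ℤ.+-*-rawRing -Raw-AlmostCommutative⟶ almostCommutativeRing
  ℤ⟶R = record
    { ⟦_⟧    = ⟦_⟧
    ; +-homo = ⟦+⟧
    ; *-homo = ⟦*⟧
    ; -‿homo = ⟦-⟧
    ; 0-homo = refl
    ; 1-homo = refl
    }

  ⟦⟧-≟ : ∀ i j → Maybe (⟦ i ⟧ ≈ ⟦ j ⟧)
  ⟦⟧-≟ i j with i ℤ.≟ j
  ... | yes ≡.refl = just refl
  ... | no _       = nothing

-- In solver expressions n :× con (+ 1) denotes ι n.
module RingSolver {c ℓ} (R : CommutativeRing c ℓ) where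
  open IntegerCoefficients R using (almostCommutativeRing; ℤ⟶R; ⟦⟧-≟)
  open import Algebra.Solver.Ring ℤ.+-*-rawRing almostCommutativeRing ℤ⟶R ⟦⟧-≟ public

module Evaluation {c ℓ} (R : CommutativeRing c ℓ) (x : CommutativeRing.Carrier R) where
  open CommutativeRing R
  open Poly R
  open RingSolver R
  open import Algebra.Properties.Ring ring using (-0#≈0#)

  eval-⊕ : ∀ p q → eval (p ⊕ q) x ≈ eval p x + eval q x
  eval-⊕ []      q       = sym (+-identityˡ _)
  eval-⊕ (a ∷ p) []      = sym (+-identityʳ _)
  eval-⊕ (a ∷ p) (b ∷ q) = trans (+-congˡ (*-congˡ (eval-⊕ p q)))
    (solve 5 (λ a b x P Q → (a :+ b) :+ x :* (P :+ Q) := (a :+ x :* P) :+ (b :+ x :* Q))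
      refl a b x (eval p x) (eval q x))

  eval-neg : ∀ p → eval (neg p) x ≈ - eval p x
  eval-neg []      = sym -0#≈0#
  eval-neg (a ∷ p) = trans (+-congˡ (*-congˡ (eval-neg p)))
    (solve 3 (λ a x P → :- a :+ x :* :- P := :- (a :+ x :* P)) refl a x (eval p x))

  eval-derivFrom-suc : ∀ i p → eval (derivFrom (suc i) p) x ≈ eval (derivFrom i p) x + eval p x
  eval-derivFrom-suc i []      = sym (+-identityʳ _)
  eval-derivFrom-suc i (a ∷ p) = trans (+-congˡ (*-congˡ (eval-derivFrom-suc (suc i) p)))
    (solve 5 (λ m a x Q P → (con (+ 1) :+ m) :* a :+ x :* (Q :+ P) := (m :* a :+ x :* Q) :+ (a :+ x :* P))
      refl (ι i) a x (eval (derivFrom (suc i) p) x) (eval p x))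

  eval-derivFrom-⊕ : ∀ i p q → eval (derivFrom i (p ⊕ q)) x ≈ eval (derivFrom i p) x + eval (derivFrom i q) x
  eval-derivFrom-⊕ i []      q       = sym (+-identityˡ _)
  eval-derivFrom-⊕ i (a ∷ p) []      = sym (+-identityʳ _)
  eval-derivFrom-⊕ i (a ∷ p) (b ∷ q) = trans (+-congˡ (*-congˡ (eval-derivFrom-⊕ (suc i) p q)))
    (solve 6 (λ m a b x P Q → m :* (a :+ b) :+ x :* (P :+ Q) := (m :* a :+ x :* P) :+ (m :* b :+ x :* Q))
      refl (ι i) a b x (eval (derivFrom (suc i) p) x) (eval (derivFrom (suc i) q) x))

  eval-derivFrom-neg : ∀ i p → eval (derivFrom i (neg p)) x ≈ - eval (derivFrom i p) x
  eval-derivFrom-neg i []      = sym -0#≈0#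
  eval-derivFrom-neg i (a ∷ p) = trans (+-congˡ (*-congˡ (eval-derivFrom-neg (suc i) p)))
    (solve 4 (λ m a x P → m :* :- a :+ x :* :- P := :- (m :* a :+ x :* P))
      refl (ι i) a x (eval (derivFrom (suc i) p) x))

  eval-derivFrom-zero : ∀ p → eval (derivFrom 0 p) x ≈ x * eval (deriv p) x
  eval-derivFrom-zero []      = sym (zeroʳ _)
  eval-derivFrom-zero (a ∷ p) = trans (+-congʳ (zeroˡ _)) (+-identityˡ _)

  eval-deriv-⊕ : ∀ p q → eval (deriv (p ⊕ q)) x ≈ eval (deriv p) x + eval (deriv q) x
  eval-deriv-⊕ []      q       = sym (+-identityˡ _)
  eval-deriv-⊕ (a ∷ p) []      = sym (+-identityʳ _)
  eval-deriv-⊕ (a ∷ p) (b ∷ q) = eval-derivFrom-⊕ 1 p q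

  eval-deriv-neg : ∀ p → eval (deriv (neg p)) x ≈ - eval (deriv p) x
  eval-deriv-neg []      = sym -0#≈0#
  eval-deriv-neg (a ∷ p) = eval-derivFrom-neg 1 p

  eval-deriv-shift : ∀ p → eval (deriv (shift p)) x ≈ x * eval (deriv p) x + eval p x
  eval-deriv-shift p = trans (eval-derivFrom-suc 0 p) (+-congʳ (eval-derivFrom-zero p))

module Chebyshev {c ℓ} (R : CommutativeRing c ℓ) (x : CommutativeRing.Carrier R) where
  open CommutativeRing R
  open Poly R
  open RingSolver R
  open Evaluation R x
  open import Algebra.Properties.Ring ring using (x≈y⇒x∙y⁻¹≈ε)
  open import Relation.Binary.Reasoning.Setoid setoid

  T T′ U : ℕ → Carrier
  T  n = eval (cheb n) x
  T′ n = eval (deriv (cheb n)) x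
  U zero          = 0#
  U (suc zero)    = 1#
  U (suc (suc n)) = x * U (suc n) - U n

  T-rec : ∀ n → T (suc (suc n)) ≈ x * T (suc n) - T n
  T-rec n = begin
    eval (shift (cheb (suc n)) ⊕ neg (cheb n)) x   ≈⟨ eval-⊕ (shift (cheb (suc n))) (neg (cheb n)) ⟩
    (0# + x * T (suc n)) + eval (neg (cheb n)) x   ≈⟨ +-cong (+-identityˡ _) (eval-neg (cheb n)) ⟩
    x * T (suc n) - T n                            ∎

  T′-rec : ∀ n → T′ (suc (suc n)) ≈ (x * T′ (suc n) + T (suc n)) - T′ n
  T′-rec n = trans (eval-deriv-⊕ (shift (cheb (suc n))) (neg (cheb n)))
    (+-cong (eval-deriv-shift (cheb (suc n))) (eval-deriv-neg (cheb n)))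

  T≈U-U : ∀ n → T (suc n) ≈ U (suc (suc n)) - U n
  T≈U-U zero          = solve 1 (λ x → con (+ 0) :+ x :* (con (+ 1) :+ x :* con (+ 0))
                                     := (x :* con (+ 1) :- con (+ 0)) :- con (+ 0)) refl x
  T≈U-U (suc zero)    = trans (T-rec 0)
    (solve 1 (λ x → x :* (con (+ 0) :+ x :* (con (+ 1) :+ x :* con (+ 0))) :- (con (+ 2) :+ x :* con (+ 0))
                 := (x :* (x :* con (+ 1) :- con (+ 0)) :- con (+ 1)) :- con (+ 1)) refl x)
  T≈U-U (suc (suc n)) = trans (T-rec (suc n)) (trans (+-cong (*-congˡ (T≈U-U (suc n))) (-‿cong (T≈U-U n)))
    (solve 3 (λ x u v → x :* ((x :* (x :* u :- v) :- u) :- u) :- ((x :* u :- v) :- v)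
                     := (x :* (x :* (x :* u :- v) :- u) :- (x :* u :- v)) :- (x :* u :- v))
      refl x (U (suc n)) (U n)))

  T′≈ι*U : ∀ n → T′ n ≈ ι n * U n
  T′≈ι*U zero          = sym (zeroˡ _)
  T′≈ι*U (suc zero)    = solve 1 (λ x → 1 :× con (+ 1) :* con (+ 1) :+ x :* con (+ 0)
                                      := 1 :× con (+ 1) :* con (+ 1)) refl x
  T′≈ι*U (suc (suc n)) = trans (T′-rec n)
    (trans (+-cong (+-cong (*-congˡ (T′≈ι*U (suc n))) (T≈U-U n)) (-‿cong (T′≈ι*U n)))
    (solve 4 (λ x m u v → (x :* ((con (+ 1) :+ m) :* u) :+ ((x :* u :- v) :- v)) :- m :* v
                       := (con (+ 1) :+ (con (+ 1) :+ m)) :* (x :* u :- v))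
      refl x (ι n) (U (suc n)) (U n)))

  U-cassini : ∀ n → U (suc n) * U (suc n) - x * U (suc n) * U n + U n * U n ≈ 1#
  U-cassini zero    = solve 1 (λ x → con (+ 1) :* con (+ 1) :- x :* con (+ 1) :* con (+ 0) :+ con (+ 0) :* con (+ 0)
                                  := con (+ 1)) refl x
  U-cassini (suc n) = trans
    (solve 3 (λ x u v → (x :* u :- v) :* (x :* u :- v) :- x :* (x :* u :- v) :* u :+ u :* u
                     := u :* u :- x :* u :* v :+ v :* v) refl x (U (suc n)) (U n))
    (U-cassini n)

  T²-4≈[x²-4]U² : ∀ n → T n * T n - ι 4 ≈ (x * x - ι 4) * (U n * U n)
  T²-4≈[x²-4]U² zero    = solve 1 (λ x → (con (+ 2) :+ x :* con (+ 0)) :* (con (+ 2) :+ x :* con (+ 0)) :- 4 :× con (+ 1)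
                                        := (x :* x :- 4 :× con (+ 1)) :* (con (+ 0) :* con (+ 0))) refl x
  T²-4≈[x²-4]U² (suc n) = begin
    T (suc n) * T (suc n) - ι 4                                        ≈⟨ +-congʳ (*-cong (T≈U-U n) (T≈U-U n)) ⟩
    (x * u - v - v) * (x * u - v - v) - ι 4                            ≈⟨ expand ⟩
    (x * x - ι 4) * (u * u) + ι 4 * (u * u - x * u * v + v * v - 1#)   ≈⟨ +-congˡ (*-congˡ (x≈y⇒x∙y⁻¹≈ε (U-cassini n))) ⟩
    (x * x - ι 4) * (u * u) + ι 4 * 0#                                 ≈⟨ trans (+-congˡ (zeroʳ _)) (+-identityʳ _) ⟩
    (x * x - ι 4) * (u * u)                                            ∎
    where
    u v : Carrier
    u = U (suc n)
    v = U n

    expand : (x * u - v - v) * (x * u - v - v) - ι 4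
           ≈ (x * x - ι 4) * (u * u) + ι 4 * (u * u - x * u * v + v * v - 1#)
    expand = solve 3 (λ x u v → ((x :* u :- v) :- v) :* ((x :* u :- v) :- v) :- 4 :× con (+ 1)
                             := (x :* x :- 4 :× con (+ 1)) :* (u :* u)
                                :+ 4 :× con (+ 1) :* (u :* u :- x :* u :* v :+ v :* v :- con (+ 1)))
      refl x u v

module _ {c ℓ} (R : CommutativeRing c ℓ) where
  open CommutativeRing R
  open Poly R
  open RingSolver R
  open import Algebra.Properties.Ring ring using (-‿+-comm)

  2+2≈4 : ι 2 + ι 2 ≈ ι 4
  2+2≈4 = solve 0 (2 :× con (+ 1) :+ 2 :× con (+ 1) := 4 :× con (+ 1)) refl

  ±2+±2≈4∨0∨-4 : ∀ {a b} → a ≈ ι 2 ⊎ a ≈ - ι 2 → b ≈ ι 2 ⊎ b ≈ - ι 2 →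
                   a + b ≈ ι 4 ⊎ a + b ≈ 0# ⊎ a + b ≈ - ι 4
  ±2+±2≈4∨0∨-4 (inj₁ a≈2)  (inj₁ b≈2)  = inj₁ (trans (+-cong a≈2 b≈2) 2+2≈4)
  ±2+±2≈4∨0∨-4 (inj₁ a≈2)  (inj₂ b≈-2) = inj₂ (inj₁ (trans (+-cong a≈2 b≈-2) (-‿inverseʳ _)))
  ±2+±2≈4∨0∨-4 (inj₂ a≈-2) (inj₁ b≈2)  = inj₂ (inj₁ (trans (+-cong a≈-2 b≈2) (-‿inverseˡ _)))
  ±2+±2≈4∨0∨-4 (inj₂ a≈-2) (inj₂ b≈-2) =
    inj₂ (inj₂ (trans (+-cong a≈-2 b≈-2) (trans (-‿+-comm _ _) (-‿cong 2+2≈4))))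

  NoZeroDivisors : Set (c ⊔ ℓ)
  NoZeroDivisors = ∀ {a b} → ¬ a ≈ 0# → a * b ≈ 0# → b ≈ 0#

  isField⇒noZeroDivisors : IsField R → NoZeroDivisors
  isField⇒noZeroDivisors isField {a} {b} a≉0 ab≈0 with IsField.inverse isField a a≉0
  ... | a⁻¹ , aa⁻¹≈1 = begin
    b              ≈⟨ *-identityˡ b ⟨
    1# * b         ≈⟨ *-congʳ aa⁻¹≈1 ⟨
    (a * a⁻¹) * b  ≈⟨ solve 3 (λ a a⁻¹ b → (a :* a⁻¹) :* b := a⁻¹ :* (a :* b)) refl a a⁻¹ b ⟩
    a⁻¹ * (a * b)  ≈⟨ *-congˡ ab≈0 ⟩
    a⁻¹ * 0#       ≈⟨ zeroʳ a⁻¹ ⟩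
    0#             ∎
    where open import Relation.Binary.Reasoning.Setoid setoid

module CriticalValues {c ℓ} (R : CommutativeRing c ℓ) (noZeroDivisors : NoZeroDivisors R) where
  open CommutativeRing R
  open Poly R
  open RingSolver R
  open import Algebra.Properties.Ring ring using (x∙y⁻¹≈ε⇒x≈y; +-inverseˡ-unique)
  open import Relation.Binary.Reasoning.Setoid setoid

  -- Constructively a² = 4 only excludes a ≠ ±2, since a ≈ 2 need not be decidable.
  a²≈4⇒¬¬a≈±2 : ∀ a → a * a - ι 4 ≈ 0# → ¬ ¬ (a ≈ ι 2 ⊎ a ≈ - ι 2)
  a²≈4⇒¬¬a≈±2 a a²-4≈0 a≉±2 = a≉±2 (inj₂ (+-inverseˡ-unique a (ι 2) a+2≈0))
    where
    a-2≉0 : ¬ a - ι 2 ≈ 0#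
    a-2≉0 = a≉±2 ∘ inj₁ ∘ x∙y⁻¹≈ε⇒x≈y a (ι 2)

    [a-2][a+2]≈0 : (a - ι 2) * (a + ι 2) ≈ 0#
    [a-2][a+2]≈0 = trans
      (solve 1 (λ a → (a :- 2 :× con (+ 1)) :* (a :+ 2 :× con (+ 1)) := a :* a :- 4 :× con (+ 1)) refl a)
      a²-4≈0

    a+2≈0 : a + ι 2 ≈ 0#
    a+2≈0 = noZeroDivisors a-2≉0 [a-2][a+2]≈0

  T′≈0⇒¬¬T≈±2 : ∀ x d → ¬ ι d ≈ 0# → Chebyshev.T′ R x d ≈ 0# →
                ¬ ¬ (Chebyshev.T R x d ≈ ι 2 ⊎ Chebyshev.T R x d ≈ - ι 2)
  T′≈0⇒¬¬T≈±2 x d ιd≉0 T′≈0 = a²≈4⇒¬¬a≈±2 (T d) (begin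
    T d * T d - ι 4                ≈⟨ T²-4≈[x²-4]U² d ⟩
    (x * x - ι 4) * (U d * U d)    ≈⟨ *-congˡ (*-congˡ Ud≈0) ⟩
    (x * x - ι 4) * (U d * 0#)     ≈⟨ trans (*-congˡ (zeroʳ _)) (zeroʳ _) ⟩
    0#                             ∎)
    where
    open Chebyshev R x
    Ud≈0 : U d ≈ 0#
    Ud≈0 = noZeroDivisors ιd≉0 (trans (sym (T′≈ι*U d)) T′≈0)

proposition2 : ∀ {c ℓ} (K : CommutativeRing c ℓ) → IsField K → (d : ℕ) → d ≥ 1 → (k : CommutativeRing.Carrier K) → ¬ (CommutativeRing._≈_ K (Poly.ι K d) (CommutativeRing.0# K)) → ¬ (CommutativeRing._≈_ K k (CommutativeRing.0# K)) → ¬ (CommutativeRing._≈_ K k (Poly.ι K 4)) → ¬ (CommutativeRing._≈_ K k (CommutativeRing.-_ K (Poly.ι K 4))) → Poly.Nonsingular K d k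
proposition2 K isField d _ k ιd≉0 k≉0 k≉4 k≉-4 x y onCurve T′x≈0 T′y≈0 =
  T′≈0⇒¬¬T≈±2 x d ιd≉0 T′x≈0 λ Tx≈±2 →
  T′≈0⇒¬¬T≈±2 y d ιd≉0 T′y≈0 λ Ty≈±2 →
  [ k≉4 ∘ k≈ , [ k≉0 ∘ k≈ , k≉-4 ∘ k≈ ] ] (±2+±2≈4∨0∨-4 K Tx≈±2 Ty≈±2)
  where
  open CommutativeRing K using (_≈_; _+_; sym; trans)
  open Chebyshev K using (T)
  open CriticalValues K (isField⇒noZeroDivisors K isField)

  k≈ : ∀ {v} → T x d + T y d ≈ v → k ≈ v
  k≈ = trans (sym onCurve)
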